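{- Let $n\ge 3$ be an integer, let $i\in\{2,\ldots,n-1\}$, and let $S_i=[n-i]=\{1,2,\ldots,n-i\}$. Then \[\max\{d_\ell(\sigma,\rho):\sigma,\rho\in\mathcal{D}(S_i;n),\ \sigma\ne\rho\}=\max\{i-1,\,n-i\}.\]
   Context: $S_n$ is the symmetric group on $[n]=\{1,\ldots,n\}$, with permutations in one-line notation $\sigma=\sigma_1\cdots\sigma_n$. The descent set of $\sigma$ is $\mathcal{D}(\sigma)=\{j\in[n-1]:\sigma_j>\sigma_{j+1}\}$, and for $S\subseteq[n-1]$, $\mathcal{D}(S;n)=\{\sigma\in S_n:\mathcal{D}(\sigma)=S\}$. The $\ell_\infty$-metric is $d_\ell(\sigma,\rho)=\max\{|\sigma_j-\rho_j|:1\le j\le n\}$. -}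

module Defs where

open import Data.Nat using (ℕ; zero; suc; _<_; _≤_; _>_; _∸_; _⊔_; ∣_-_∣)
open import Data.Fin using (Fin; toℕ; fromℕ<)
open import Data.Fin.Permutation using (Permutation′; _⟨$⟩ʳ_)
open import Data.List using (foldr; map; allFin)
open import Function.Bundles using (_⇔_)
open import Data.Nat.Properties using (<-trans; n<1+n)

-- σ_j as a natural number, with 0-indexed position k : Fin n
-- (values are 0-indexed too; this shifts both permutations equally and
--  does not affect descents or differences).
val : ∀ {n} → Permutation′ n → Fin n → ℕ
val σ k = toℕ (σ ⟨$⟩ʳ k)

-- The 1-indexed position j+1 ∈ [n-1] is a descent iff σ_{j+1} > σ_{j+2},
-- i.e. (0-indexed) val σ j > val σ (j+1).
HasDescentSet : ∀ {n} → Permutation′ n → (ℕ → Set) → Set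
HasDescentSet {n} σ S =
  ∀ (j : ℕ) (p : suc j < n) →
    (val σ (fromℕ< (<-trans (n<1+n j) p)) > val σ (fromℕ< p)) ⇔ S (suc j)

Sset : ℕ → ℕ → ℕ → Set
Sset n i j = (1 ≤ j) Data.Product.× (j ≤ n ∸ i)
  where import Data.Product

dℓ : ∀ {n} → Permutation′ n → Permutation′ n → ℕ
dℓ {n} σ ρ = foldr _⊔_ 0 (map (λ k → ∣ val σ k - val ρ k ∣) (allFin n))

_≢ₚ_ : ∀ {n} → Permutation′ n → Permutation′ n → Set
_≢ₚ_ {n} σ ρ = (∀ k → σ ⟨$⟩ʳ k ≡ ρ ⟨$⟩ʳ k) → ⊥
  where open import Relation.Binary.PropositionalEquality using (_≡_)
        open import Data.Empty using (⊥)

{-# OPTIONS --safe #-}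
-- Write i = a + 1 and n = a + 1 + p, so that i - 1 = a and n - i = p, and index positions
-- and values from 0.  A permutation with descent set {1, …, p} is a valley: strictly
-- decreasing on positions 0, …, p and strictly increasing on p, …, a + p.  Strict
-- monotonicity pins each entry into a window of width a or p: k + σ_k ∈ [p, a + p] for
-- k ≤ p, and p + σ_k ∈ [k, k + p] for k ≥ p.  Hence two such permutations are at
-- ℓ∞-distance at most a ⊔ p.  The valleys σ₀ = a+p, …, a+1, 0, 1, …, a and
-- ρ₀ = p, p-1, …, 0, p+1, …, a+p differ by a in the first position and by p in the last.
module Submission where

open import Data.Fin using (Fin; zero; toℕ; fromℕ; fromℕ<)
open import Data.Fin.Permutation using (Permutation′; _⟨$⟩ʳ_; _∘ₚ_; permutation; reverse)
open import Data.Fin.Properties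
  using (toℕ<n; toℕ-fromℕ; toℕ-fromℕ<; fromℕ<-toℕ; toℕ-injective; opposite-prop)
open import Data.List.Properties using (foldr-preservesᵇ; foldr-preservesᵒ)
import Data.List.Relation.Unary.All.Properties as All
import Data.List.Relation.Unary.Any.Properties as Any
open import Data.Nat
open import Data.Nat.Properties
open import Data.Product using (_×_; _,_; proj₂; Σ-syntax; ∃₂)
open import Data.Sum using (inj₁; inj₂; [_,_])
open import Function.Base using (_∘_)
open import Function.Bundles using (_⇔_; mk⇔; Equivalence; Injection)
open import Function.Construct.Composition using (_⇔-∘_)
open import Function.Construct.Symmetry using (⇔-sym)
open import Function.Properties.Inverse using (Inverse⇒Injection)
open import Relation.Binary.PropositionalEquality
  using (_≡_; _≢_; refl; sym; trans; cong; cong₂; subst; module ≡-Reasoning)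
open import Relation.Nullary using (yes; no)
open import Relation.Nullary.Negation using (contradiction)

open import Defs

record Represents {n} (σ : Permutation′ n) (f : ℕ → ℕ) : Set where
  constructor represents
  field val≡ : ∀ k → val σ k ≡ f (toℕ k)

open Represents

module _ {n} {σ : Permutation′ n} {f : ℕ → ℕ} (σ≗f : Represents σ f) where

  represents-fromℕ< : ∀ {j} (j<n : j < n) → val σ (fromℕ< j<n) ≡ f j
  represents-fromℕ< j<n = trans (val≡ σ≗f _) (cong f (toℕ-fromℕ< j<n))

  represents-< : ∀ {j} → j < n → f j < n
  represents-< j<n = subst (_< n) (represents-fromℕ< j<n) (toℕ<n _)

  represents-injective : ∀ {j k} (j<n : j < n) (k<n : k < n) → f j ≡ f k → j ≡ k
  represents-injective {j} {k} j<n k<n fj≡fk = begin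
    j                ≡⟨ toℕ-fromℕ< j<n ⟨
    toℕ (fromℕ< j<n) ≡⟨ cong toℕ (Injection.injective (Inverse⇒Injection σ) σj≡σk) ⟩
    toℕ (fromℕ< k<n) ≡⟨ toℕ-fromℕ< k<n ⟩
    k                ∎
    where
    open ≡-Reasoning
    σj≡σk : σ ⟨$⟩ʳ fromℕ< j<n ≡ σ ⟨$⟩ʳ fromℕ< k<n
    σj≡σk = toℕ-injective
      (trans (represents-fromℕ< j<n) (trans fj≡fk (sym (represents-fromℕ< k<n))))

  hasDescentSet⇔ : ∀ {S} →
    HasDescentSet σ S ⇔ (∀ j → suc j < n → (f (suc j) < f j) ⇔ S (suc j))
  hasDescentSet⇔ {S} = mk⇔
    (λ H j q → subst (_⇔ S (suc j)) (descent≡ q) (H j q))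
    (λ H j q → subst (_⇔ S (suc j)) (sym (descent≡ q)) (H j q))
    where
    descent≡ : ∀ {j} (q : suc j < n) →
      (val σ (fromℕ< (<-trans (n<1+n j) q)) > val σ (fromℕ< q)) ≡ (f (suc j) < f j)
    descent≡ {j} q = cong₂ _<_ (represents-fromℕ< q) (represents-fromℕ< (<-trans (n<1+n j) q))

valℕ : ∀ {n} → Permutation′ n → ℕ → ℕ
valℕ {n} σ j with j <? n
... | yes j<n = val σ (fromℕ< j<n)
... | no  _   = 0

represents-valℕ : ∀ {n} (σ : Permutation′ n) → Represents σ (valℕ σ)
represents-valℕ {n} σ = represents val≡valℕ
  where
  val≡valℕ : ∀ k → val σ k ≡ valℕ σ (toℕ k)
  val≡valℕ k with toℕ k <? n
  ... | yes k<n = cong (val σ) (sym (fromℕ<-toℕ k k<n))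
  ... | no  k≮n = contradiction (toℕ<n k) k≮n

record Valley (n p : ℕ) (f : ℕ → ℕ) : Set where
  field
    descending : ∀ {j} → j < p → suc j < n → f (suc j) < f j
    ascending  : ∀ {j} → p ≤ j → suc j < n → f j < f (suc j)

module _ {n p : ℕ} {f : ℕ → ℕ} where

  valley⇒descents : Valley n p f → ∀ j → suc j < n → (f (suc j) < f j) ⇔ j < p
  valley⇒descents V j q = mk⇔ descent⇒j<p (λ j<p → Valley.descending V j<p q)
    where
    descent⇒j<p : f (suc j) < f j → j < p
    descent⇒j<p descent with j <? p
    ... | yes j<p = j<p
    ... | no  j≮p = contradiction descent (<-asym (Valley.ascending V (≮⇒≥ j≮p) q))

  descents⇒valley : (∀ {j} → suc j < n → f j ≢ f (suc j)) →
    (∀ j → suc j < n → (f (suc j) < f j) ⇔ j < p) → Valley n p f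
  descents⇒valley adjacent-≢ descents = record
    { descending = λ j<p q → Equivalence.from (descents _ q) j<p
    ; ascending  = λ p≤j q →
        ≤∧≢⇒< (≮⇒≥ (≤⇒≯ p≤j ∘ Equivalence.to (descents _ q))) (adjacent-≢ q)
    }

Sset-suc⇔ : ∀ a p j → Sset (suc a + p) (suc a) (suc j) ⇔ j < p
Sset-suc⇔ a p j = mk⇔
  (subst (suc j ≤_) (m+n∸m≡n a p) ∘ proj₂)
  (λ j<p → s≤s z≤n , subst (suc j ≤_) (sym (m+n∸m≡n a p)) j<p)

module _ {a p} {σ : Permutation′ (suc a + p)} {f : ℕ → ℕ} (σ≗f : Represents σ f) where

  private
    S : ℕ → Set
    S = Sset (suc a + p) (suc a)

  hasDescentSet⇒valley : HasDescentSet σ S → Valley (suc a + p) p f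
  hasDescentSet⇒valley H = descents⇒valley adjacent-≢
    (λ j q → Sset-suc⇔ a p j ⇔-∘ Equivalence.to (hasDescentSet⇔ σ≗f {S}) H j q)
    where
    adjacent-≢ : ∀ {j} → suc j < suc a + p → f j ≢ f (suc j)
    adjacent-≢ {j} q = <⇒≢ (n<1+n j) ∘ represents-injective σ≗f (<-trans (n<1+n j) q) q

  valley⇒hasDescentSet : Valley (suc a + p) p f → HasDescentSet σ S
  valley⇒hasDescentSet V = Equivalence.from (hasDescentSet⇔ σ≗f {S})
    (λ j q → ⇔-sym (Sset-suc⇔ a p j) ⇔-∘ valley⇒descents V j q)

descending-gap : ∀ {p} {f : ℕ → ℕ} → (∀ {j} → j < p → f (suc j) < f j) →
  ∀ {j k} → j ≤ k → k ≤ p → k + f k ≤ j + f j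
descending-gap {p} {f} desc j≤k = go (≤⇒≤′ j≤k)
  where
  open ≤-Reasoning
  go : ∀ {j k} → j ≤′ k → k ≤ p → k + f k ≤ j + f j
  go ≤′-refl                      _   = ≤-refl
  go {j} {suc k} (≤′-step j≤′k) k<p = begin
    suc k + f (suc k)   ≡⟨ +-suc k (f (suc k)) ⟨
    k + suc (f (suc k)) ≤⟨ +-monoʳ-≤ k (desc k<p) ⟩
    k + f k             ≤⟨ go j≤′k (<⇒≤ k<p) ⟩
    j + f j             ∎

ascending-gap : ∀ {n p} {f : ℕ → ℕ} → (∀ {j} → p ≤ j → suc j < n → f j < f (suc j)) →
  ∀ {j k} → p ≤ j → j ≤ k → k < n → k + f j ≤ j + f k
ascending-gap {n} {p} {f} asc {j} p≤j j≤k = go (≤⇒≤′ j≤k)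
  where
  open ≤-Reasoning
  go : ∀ {k} → j ≤′ k → k < n → k + f j ≤ j + f k
  go ≤′-refl                  _   = ≤-refl
  go {suc k} (≤′-step j≤′k) k<n = begin
    suc k + f j   ≤⟨ s≤s (go j≤′k (<-trans (n<1+n k) k<n)) ⟩
    suc (j + f k) ≡⟨ +-suc j (f k) ⟨
    j + suc (f k) ≤⟨ +-monoʳ-≤ j (asc (≤-trans p≤j (≤′⇒≤ j≤′k)) k<n) ⟩
    j + f (suc k) ∎

∣-∣≤-width : ∀ {l u x y} → l ≤ x × x ≤ u → l ≤ y × y ≤ u → ∣ x - y ∣ ≤ u ∸ l
∣-∣≤-width {x = x} {y} (l≤x , x≤u) (l≤y , y≤u) with ∣m-n∣≡[m∸n]∨[n∸m] x y
... | inj₁ eq = ≤-trans (≤-reflexive eq) (∸-mono x≤u l≤y)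
... | inj₂ eq = ≤-trans (≤-reflexive eq) (∸-mono y≤u l≤x)

module _ {a p} {f : ℕ → ℕ} (V : Valley (suc a + p) p f)
         (f< : ∀ {k} → k < suc a + p → f k < suc a + p) where
  open Valley V
  open ≤-Reasoning

  valley-left-window : ∀ {k} → k ≤ p → p ≤ k + f k × k + f k ≤ a + p
  valley-left-window {k} k≤p =
    ≤-trans (m≤m+n p (f p)) (descending-gap descending′ k≤p ≤-refl) ,
    s≤s⁻¹ (≤-<-trans (descending-gap descending′ z≤n k≤p) (f< z<s))
    where
    descending′ : ∀ {j} → j < p → f (suc j) < f j
    descending′ j<p = descending j<p (s≤s (≤-trans j<p (m≤n+m p a)))

  valley-right-window : ∀ {k} → p ≤ k → k ≤ a + p → k ≤ p + f k × p + f k ≤ p + k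
  valley-right-window {k} p≤k k≤a+p =
    ≤-trans (m≤m+n k (f p)) (ascending-gap ascending ≤-refl p≤k (s≤s k≤a+p)) ,
    +-monoʳ-≤ p (+-cancelˡ-≤ (a + p) (f k) k (begin
      a + p + f k   ≤⟨ ascending-gap ascending p≤k k≤a+p ≤-refl ⟩
      k + f (a + p) ≤⟨ +-monoʳ-≤ k (s≤s⁻¹ (f< ≤-refl)) ⟩
      k + (a + p)   ≡⟨ +-comm k (a + p) ⟩
      a + p + k     ∎))

valley-distance : ∀ {a p} {f g : ℕ → ℕ} →
  Valley (suc a + p) p f → (∀ {k} → k < suc a + p → f k < suc a + p) →
  Valley (suc a + p) p g → (∀ {k} → k < suc a + p → g k < suc a + p) →
  ∀ {k} → k ≤ a + p → ∣ f k - g k ∣ ≤ a ⊔ p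
valley-distance {a} {p} {f} {g} Vf f< Vg g< {k} k≤a+p with k ≤? p
... | yes k≤p = begin
  ∣ f k - g k ∣         ≡⟨ ∣m+n-m+o∣≡∣n-o∣ k (f k) (g k) ⟨
  ∣ k + f k - k + g k ∣ ≤⟨ ∣-∣≤-width (valley-left-window Vf f< k≤p)
                                      (valley-left-window Vg g< k≤p) ⟩
  a + p ∸ p             ≡⟨ m+n∸n≡m a p ⟩
  a                     ≤⟨ m≤m⊔n a p ⟩
  a ⊔ p                 ∎
  where open ≤-Reasoning
... | no k≰p = begin
  ∣ f k - g k ∣         ≡⟨ ∣m+n-m+o∣≡∣n-o∣ p (f k) (g k) ⟨
  ∣ p + f k - p + g k ∣ ≤⟨ ∣-∣≤-width (valley-right-window Vf f< p≤k k≤a+p)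
                                      (valley-right-window Vg g< p≤k k≤a+p) ⟩
  p + k ∸ k             ≡⟨ m+n∸n≡m p k ⟩
  p                     ≤⟨ m≤n⊔m a p ⟩
  a ⊔ p                 ∎
  where
  open ≤-Reasoning
  p≤k : p ≤ k
  p≤k = ≰⇒≥ k≰p

module _ {n} (σ ρ : Permutation′ n) where

  dℓ-lub : ∀ {b} → (∀ k → ∣ val σ k - val ρ k ∣ ≤ b) → dℓ σ ρ ≤ b
  dℓ-lub {b} bound = foldr-preservesᵇ {P = _≤ b} ⊔-lub z≤n (All.map⁺ (All.tabulate⁺ bound))

  ∣-∣≤dℓ : ∀ k → ∣ val σ k - val ρ k ∣ ≤ dℓ σ ρ
  ∣-∣≤dℓ k = foldr-preservesᵒ {P = ∣ val σ k - val ρ k ∣ ≤_}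
    (λ x y → [ m≤n⇒m≤n⊔o y , m≤n⇒m≤o⊔n x ]) 0 _
    (inj₂ (Any.map⁺ (Any.tabulate⁺ k ≤-refl)))

  0<dℓ⇒≢ₚ : 0 < dℓ σ ρ → σ ≢ₚ ρ
  0<dℓ⇒≢ₚ 0<dℓ σ≈ρ =
    <⇒≱ 0<dℓ (dℓ-lub (λ k → ≤-reflexive (m≡n⇒∣m-n∣≡0 (cong toℕ (σ≈ρ k)))))

dℓ-bound : ∀ {a p} (σ ρ : Permutation′ (suc a + p)) →
  HasDescentSet σ (Sset (suc a + p) (suc a)) → HasDescentSet ρ (Sset (suc a + p) (suc a)) →
  dℓ σ ρ ≤ a ⊔ p
dℓ-bound {a} {p} σ ρ Hσ Hρ = dℓ-lub σ ρ λ k → begin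
  ∣ val σ k - val ρ k ∣                 ≡⟨ cong₂ ∣_-_∣ (val≡ σ≗f k) (val≡ ρ≗g k) ⟩
  ∣ valℕ σ (toℕ k) - valℕ ρ (toℕ k) ∣ ≤⟨ valley-distance {a} {p}
      (hasDescentSet⇒valley σ≗f Hσ) (represents-< σ≗f)
      (hasDescentSet⇒valley ρ≗g Hρ) (represents-< ρ≗g) (s≤s⁻¹ (toℕ<n k)) ⟩
  a ⊔ p                                 ∎
  where
  open ≤-Reasoning
  σ≗f : Represents σ (valℕ σ)
  σ≗f = represents-valℕ σ
  ρ≗g : Represents ρ (valℕ ρ)
  ρ≗g = represents-valℕ ρ

revPrefix : ℕ → ℕ → ℕ
revPrefix q k with k ≤? q
... | yes _ = q ∸ k
... | no  _ = k

module _ {q : ℕ} where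

  revPrefix-≤ : ∀ {k} → k ≤ q → revPrefix q k ≡ q ∸ k
  revPrefix-≤ {k} k≤q with k ≤? q
  ... | yes _   = refl
  ... | no  k≰q = contradiction k≤q k≰q

  revPrefix-> : ∀ {k} → q < k → revPrefix q k ≡ k
  revPrefix-> {k} q<k with k ≤? q
  ... | yes k≤q = contradiction k≤q (<⇒≱ q<k)
  ... | no  _   = refl

  revPrefix-involutive : ∀ k → revPrefix q (revPrefix q k) ≡ k
  revPrefix-involutive k with k ≤? q
  ... | yes k≤q = trans (revPrefix-≤ (m∸n≤m q k)) (m∸[m∸n]≡n k≤q)
  ... | no  k≰q = revPrefix-> (≰⇒> k≰q)

  revPrefix-< : ∀ {n k} → q < n → k < n → revPrefix q k < n
  revPrefix-< {k = k} q<n k<n with k ≤? q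
  ... | yes _ = ≤-<-trans (m∸n≤m q k) q<n
  ... | no  _ = k<n

  revPrefix-descending : ∀ {j} → j < q → revPrefix q (suc j) < revPrefix q j
  revPrefix-descending {j} j<q rewrite revPrefix-≤ j<q | revPrefix-≤ (<⇒≤ j<q) =
    ∸-monoʳ-< (n<1+n j) j<q

  revPrefix-ascending : ∀ {j} → q ≤ j → revPrefix q j < revPrefix q (suc j)
  revPrefix-ascending {j} q≤j rewrite revPrefix-> (s≤s q≤j) with j ≤? q
  ... | yes _ = s≤s (≤-trans (m∸n≤m q j) q≤j)
  ... | no  _ = n<1+n j

module _ {n} {r : ℕ → ℕ} (r< : ∀ {k} → k < n → r k < n)
         (r-involutive : ∀ k → r (r k) ≡ k) where

  involutionₚ : Permutation′ n
  involutionₚ = permutation rₙ rₙ rₙ-involutive rₙ-involutive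
    where
    rₙ : Fin n → Fin n
    rₙ k = fromℕ< (r< (toℕ<n k))
    rₙ-involutive : ∀ k → rₙ (rₙ k) ≡ k
    rₙ-involutive k = toℕ-injective
      (trans (toℕ-fromℕ< _) (trans (cong r (toℕ-fromℕ< _)) (r-involutive (toℕ k))))

  represents-involutionₚ : Represents involutionₚ r
  represents-involutionₚ = represents λ k → toℕ-fromℕ< (r< (toℕ<n k))

revPrefixₚ : ∀ {n} q → q < n → Permutation′ n
revPrefixₚ q q<n = involutionₚ (revPrefix-< {q} q<n) (revPrefix-involutive {q})

represents-revPrefixₚ : ∀ {n} q (q<n : q < n) → Represents (revPrefixₚ q q<n) (revPrefix q)
represents-revPrefixₚ q q<n = represents-involutionₚ (revPrefix-< {q} q<n) (revPrefix-involutive {q})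

represents-reverse : ∀ {n} → Represents (reverse {n}) (λ k → n ∸ suc k)
represents-reverse = represents opposite-prop

represents-∘ₚ : ∀ {n} {π τ : Permutation′ n} {f g : ℕ → ℕ} →
  Represents π f → Represents τ g → Represents (π ∘ₚ τ) (g ∘ f)
represents-∘ₚ {π = π} {g = g} π≗f τ≗g =
  represents λ k → trans (val≡ τ≗g (π ⟨$⟩ʳ k)) (cong g (val≡ π≗f k))

module _ (a p : ℕ) where

  private
    N : ℕ
    N = suc a + p
    a<N : a < N
    a<N = s≤s (m≤m+n a p)
    p<N : p < N
    p<N = s≤s (m≤n+m p a)

  σ₀ : Permutation′ N
  σ₀ = reverse ∘ₚ revPrefixₚ a a<N

  ρ₀ : Permutation′ N
  ρ₀ = revPrefixₚ p p<N

  represents-σ₀ : Represents σ₀ (λ k → revPrefix a (a + p ∸ k))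
  represents-σ₀ = represents-∘ₚ represents-reverse (represents-revPrefixₚ a a<N)

  represents-ρ₀ : Represents ρ₀ (revPrefix p)
  represents-ρ₀ = represents-revPrefixₚ p p<N

  σ₀-valley : Valley N p (λ k → revPrefix a (a + p ∸ k))
  σ₀-valley = record
    { descending = λ {j} j<p q → subst (λ m → revPrefix a (a + p ∸ suc j) < revPrefix a m)
        (sym (a+p∸j≡1+[a+p∸[1+j]] q)) (revPrefix-ascending (a≤a+p∸[1+j] j<p))
    ; ascending  = λ {j} p≤j q → subst (λ m → revPrefix a m < revPrefix a (a + p ∸ suc j))
        (sym (a+p∸j≡1+[a+p∸[1+j]] q)) (revPrefix-descending (a+p∸[1+j]<a p≤j q))
    }
    where
    open ≤-Reasoning
    a+p∸j≡1+[a+p∸[1+j]] : ∀ {j} → suc j < N → a + p ∸ j ≡ suc (a + p ∸ suc j)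
    a+p∸j≡1+[a+p∸[1+j]] q = +-∸-assoc 1 (s≤s⁻¹ q)
    a≤a+p∸[1+j] : ∀ {j} → j < p → a ≤ a + p ∸ suc j
    a≤a+p∸[1+j] {j} j<p = begin
      a             ≡⟨ m+n∸n≡m a p ⟨
      a + p ∸ p     ≤⟨ ∸-monoʳ-≤ (a + p) j<p ⟩
      a + p ∸ suc j ∎
    a+p∸[1+j]<a : ∀ {j} → p ≤ j → suc j < N → a + p ∸ suc j < a
    a+p∸[1+j]<a {j} p≤j q = begin-strict
      a + p ∸ suc j <⟨ ∸-monoʳ-< (s≤s p≤j) (s≤s⁻¹ q) ⟩
      a + p ∸ p     ≡⟨ m+n∸n≡m a p ⟩
      a             ∎

  ρ₀-valley : Valley N p (revPrefix p)
  ρ₀-valley = record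
    { descending = λ j<p _ → revPrefix-descending j<p
    ; ascending  = λ p≤j _ → revPrefix-ascending p≤j
    }

  σ₀-descentSet : HasDescentSet σ₀ (Sset N (suc a))
  σ₀-descentSet = valley⇒hasDescentSet represents-σ₀ σ₀-valley

  ρ₀-descentSet : HasDescentSet ρ₀ (Sset N (suc a))
  ρ₀-descentSet = valley⇒hasDescentSet represents-ρ₀ ρ₀-valley

  module _ (1≤a : 1 ≤ a) (1≤p : 1 ≤ p) where
    open ≡-Reasoning

    σ₀-first : val σ₀ zero ≡ a + p
    σ₀-first = trans (val≡ represents-σ₀ zero) (revPrefix-> (m<m+n a 1≤p))

    ρ₀-first : val ρ₀ zero ≡ p
    ρ₀-first = trans (val≡ represents-ρ₀ zero) (revPrefix-≤ z≤n)

    σ₀-last : val σ₀ (fromℕ (a + p)) ≡ a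
    σ₀-last = begin
      val σ₀ (fromℕ (a + p))                    ≡⟨ val≡ represents-σ₀ (fromℕ (a + p)) ⟩
      revPrefix a (a + p ∸ toℕ (fromℕ (a + p))) ≡⟨ cong (revPrefix a ∘ (a + p ∸_))
                                                         (toℕ-fromℕ (a + p)) ⟩
      revPrefix a (a + p ∸ (a + p))             ≡⟨ cong (revPrefix a) (n∸n≡0 (a + p)) ⟩
      revPrefix a 0                             ≡⟨ revPrefix-≤ z≤n ⟩
      a                                         ∎

    ρ₀-last : val ρ₀ (fromℕ (a + p)) ≡ a + p
    ρ₀-last = begin
      val ρ₀ (fromℕ (a + p))              ≡⟨ val≡ represents-ρ₀ (fromℕ (a + p)) ⟩
      revPrefix p (toℕ (fromℕ (a + p))) ≡⟨ cong (revPrefix p) (toℕ-fromℕ (a + p)) ⟩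
      revPrefix p (a + p)               ≡⟨ revPrefix-> (m<n+m p 1≤a) ⟩
      a + p                             ∎

    dℓ-σ₀-ρ₀ : dℓ σ₀ ρ₀ ≡ a ⊔ p
    dℓ-σ₀-ρ₀ = ≤-antisym (dℓ-bound {a} {p} σ₀ ρ₀ σ₀-descentSet ρ₀-descentSet)
                         (⊔-lub a≤dℓ p≤dℓ)
      where
      a≤dℓ : a ≤ dℓ σ₀ ρ₀
      a≤dℓ = subst (_≤ dℓ σ₀ ρ₀)
        (trans (cong₂ ∣_-_∣ σ₀-first ρ₀-first)
               (trans (m≤n⇒∣n-m∣≡n∸m (m≤n+m p a)) (m+n∸n≡m a p)))
        (∣-∣≤dℓ σ₀ ρ₀ zero)
      p≤dℓ : p ≤ dℓ σ₀ ρ₀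
      p≤dℓ = subst (_≤ dℓ σ₀ ρ₀)
        (trans (cong₂ ∣_-_∣ σ₀-last ρ₀-last) (∣m-m+n∣≡n a p))
        (∣-∣≤dℓ σ₀ ρ₀ (fromℕ (a + p)))

    σ₀≢ₚρ₀ : σ₀ ≢ₚ ρ₀
    σ₀≢ₚρ₀ = 0<dℓ⇒≢ₚ σ₀ ρ₀ (subst (0 <_) (sym dℓ-σ₀-ρ₀) (≤-trans 1≤a (m≤m⊔n a p)))

valley-sides : ∀ {n i} → 2 ≤ i → i ≤ n ∸ 1 →
  ∃₂ λ a p → i ≡ suc a × n ≡ suc a + p × 1 ≤ a × 1 ≤ p
valley-sides {suc n} {suc a} (s≤s 1≤a) a<n =
  a , suc n ∸ suc a , refl , sym (m+[n∸m]≡n (m≤n⇒m≤1+n a<n)) , 1≤a , m<n⇒0<n∸m (s≤s a<n)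

theorem4p1 : (n i : ℕ) → 3 ≤ n → 2 ≤ i → i ≤ n ∸ 1 →
    (Σ[ σ ∈ Permutation′ n ] Σ[ ρ ∈ Permutation′ n ]
      (HasDescentSet σ (Sset n i) × HasDescentSet ρ (Sset n i) × σ ≢ₚ ρ
        × dℓ σ ρ ≡ (i ∸ 1) ⊔ (n ∸ i)))
    × ((σ ρ : Permutation′ n) → HasDescentSet σ (Sset n i) → HasDescentSet ρ (Sset n i)
        → σ ≢ₚ ρ → dℓ σ ρ ≤ (i ∸ 1) ⊔ (n ∸ i))
theorem4p1 n i _ 2≤i i≤n∸1 with valley-sides {n} 2≤i i≤n∸1
... | a , p , refl , refl , 1≤a , 1≤p =
  (σ₀ a p , ρ₀ a p , σ₀-descentSet a p , ρ₀-descentSet a p , σ₀≢ₚρ₀ a p 1≤a 1≤p ,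
   trans (dℓ-σ₀-ρ₀ a p 1≤a 1≤p) a⊔p≡) ,
  λ σ ρ Hσ Hρ _ → ≤-trans (dℓ-bound {a} {p} σ ρ Hσ Hρ) (≤-reflexive a⊔p≡)
  where
  a⊔p≡ : a ⊔ p ≡ (suc a ∸ 1) ⊔ (suc a + p ∸ suc a)
  a⊔p≡ = cong (a ⊔_) (sym (m+n∸m≡n a p))
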